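{- Let $n,\ell$ be positive integers with $\ell$ divisible by $100$, and let $\mathcal{S}\subseteq\{0,1\}^\ell$ be a set with $|\mathcal{S}|=n$ such that $\mathrm{Hw}(x)=\ell/2$ for each $x\in\mathcal{S}$ and $(1/2-1/100)\ell<\mathrm{Ham}(x,y)<(1/2+1/100)\ell$ for all distinct $x,y\in\mathcal{S}$. Define $$\mathcal{F}=\{y\in\{0,1\}^\ell : \mathrm{Ham}(x,y)\le (1-1/10)\ell \text{ for all } x\in\mathcal{S}\}.$$ Let $u\in\{0,1\}^\ell$. Then: (1) If $u\in\mathcal{S}$, then $\mathrm{Ham}(u,y)\le(1-1/10)\ell$ for each $y\in\mathcal{F}$. (2) If $\mathrm{Ham}(x,u)\ge \ell/20$ for all $x\in\mathcal{S}$, then there exists $y\in\mathcal{F}$ such that $\mathrm{Ham}(u,y)\ge(1-1/20)\ell$.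
   Context: For equal-length binary strings $x,y$, $\mathrm{Ham}(x,y)$ is the number of positions on which they differ, and $\mathrm{Hw}(x)$ is the number of $1$s in $x$. -}

module Defs where

open import Data.Bool using (Bool; true; false)
open import Data.Nat using (ℕ; zero; suc; _+_; _*_; _≤_)
open import Data.Vec using (Vec; []; _∷_)
open import Data.List using (List)
open import Data.List.Membership.Propositional using (_∈_)

Hw : ∀ {ℓ} → Vec Bool ℓ → ℕ
Hw [] = 0
Hw (true ∷ x) = suc (Hw x)
Hw (false ∷ x) = Hw x

Ham : ∀ {ℓ} → Vec Bool ℓ → Vec Bool ℓ → ℕ
Ham [] [] = 0
Ham (true ∷ x) (true ∷ y) = Ham x y
Ham (false ∷ x) (false ∷ y) = Ham x y
Ham (true ∷ x) (false ∷ y) = suc (Ham x y)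
Ham (false ∷ x) (true ∷ y) = suc (Ham x y)

-- Membership in 𝓕 = { y : Ham(x,y) ≤ (1 - 1/10) ℓ for all x ∈ S },
-- with the inequality multiplied through by 10.
InF : ∀ {ℓ} → List (Vec Bool ℓ) → Vec Bool ℓ → Set
InF {ℓ} S y = ∀ x → x ∈ S → 10 * Ham x y ≤ 9 * ℓ

module Submission where

-- Write ℓ = 100q.  Part (1) is the definition of 𝓕 read at x = u.
-- For part (2) there are two cases.
--   * Every centre x ∈ S has Ham(x,u) ≥ ℓ/10.  Then the complement ū of u lies
--     in 𝓕, since Ham(x,ū) = ℓ - Ham(x,u), and Ham(u,ū) = ℓ.
--   * Some centre x₀ has Ham(x₀,u) < ℓ/10.  Then x₀ and u agree in more than
--     k = ℓ/20 positions; let y be ū with the first k of them reset to u's bit.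
--     Then Ham(u,y) = ℓ - k = 19ℓ/20, Ham(x₀,y) = ℓ - k - Ham(x₀,u) ≤ 9ℓ/10
--     because Ham(x₀,u) ≥ ℓ/20, and for any other centre x the triangle
--     inequality with Ham(x,x₀) > 49ℓ/100 gives Ham(x,u) > 39ℓ/100, whence
--     Ham(x,y) ≤ k + Ham(x,ū) < 66ℓ/100.
-- The file first collects general facts on Hamming distance and complements,
-- then defines the partial complement y and computes its distances, then the
-- linear arithmetic of the two cases, then the two cases as witness lemmas,
-- and finally assembles the theorem.

open import Defs
open import Data.Bool using (Bool; true; false; not)
import Data.Bool.Properties as Bool
open import Data.Nat using (ℕ; zero; suc; _+_; _*_; _≤_; _<_; s≤s; z≤n; _<?_)
open import Data.Nat.Properties
open import Data.Nat.Divisibility using (_∣_; divides)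
open import Data.Nat.Tactic.RingSolver using (solve-∀)
open import Data.Vec using (Vec; []; _∷_; map)
open import Data.Vec.Properties using (≡-dec)
open import Data.List using (List; length)
open import Data.List.Membership.Propositional using (_∈_; find; lose)
open import Data.List.Relation.Unary.Unique.Propositional using (Unique)
open import Data.List.Relation.Unary.Any using (any?)
open import Data.Product using (_×_; Σ; _,_; proj₁)
open import Relation.Binary.PropositionalEquality
  using (_≡_; _≢_; refl; sym; trans; cong; module ≡-Reasoning)
open import Relation.Nullary using (yes; no)

private
  variable
    ℓ : ℕ

≤-suc-right : ∀ {c} a b → c ≤ a + b → suc c ≤ a + suc b
≤-suc-right a b c≤ = ≤-trans (s≤s c≤) (≤-reflexive (sym (+-suc a b)))

≤-suc-both : ∀ {c} a b → c ≤ a + b → c ≤ suc a + suc b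
≤-suc-both a b c≤ = ≤-trans c≤ (+-mono-≤ (n≤1+n a) (n≤1+n b))

ham-sym : (x y : Vec Bool ℓ) → Ham x y ≡ Ham y x
ham-sym [] [] = refl
ham-sym (true ∷ x) (true ∷ y) = ham-sym x y
ham-sym (false ∷ x) (false ∷ y) = ham-sym x y
ham-sym (true ∷ x) (false ∷ y) = cong suc (ham-sym x y)
ham-sym (false ∷ x) (true ∷ y) = cong suc (ham-sym x y)

ham-triangle : (x y z : Vec Bool ℓ) → Ham x z ≤ Ham x y + Ham y z
ham-triangle [] [] [] = z≤n
ham-triangle (true ∷ x) (true ∷ y) (true ∷ z) = ham-triangle x y z
ham-triangle (true ∷ x) (true ∷ y) (false ∷ z) = ≤-suc-right _ _ (ham-triangle x y z)
ham-triangle (true ∷ x) (false ∷ y) (true ∷ z) = ≤-suc-both _ _ (ham-triangle x y z)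
ham-triangle (true ∷ x) (false ∷ y) (false ∷ z) = s≤s (ham-triangle x y z)
ham-triangle (false ∷ x) (true ∷ y) (true ∷ z) = s≤s (ham-triangle x y z)
ham-triangle (false ∷ x) (true ∷ y) (false ∷ z) = ≤-suc-both _ _ (ham-triangle x y z)
ham-triangle (false ∷ x) (false ∷ y) (true ∷ z) = ≤-suc-right _ _ (ham-triangle x y z)
ham-triangle (false ∷ x) (false ∷ y) (false ∷ z) = ham-triangle x y z

complement : Vec Bool ℓ → Vec Bool ℓ
complement = map not

-- Every position is a mismatch with exactly one of u and ū.
ham-complement : (x u : Vec Bool ℓ) → Ham x (complement u) + Ham x u ≡ ℓ
ham-complement [] [] = refl
ham-complement (true ∷ x) (true ∷ u) = cong suc (ham-complement x u)
ham-complement (false ∷ x) (false ∷ u) = cong suc (ham-complement x u)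
ham-complement (true ∷ x) (false ∷ u) = trans (+-suc _ _) (cong suc (ham-complement x u))
ham-complement (false ∷ x) (true ∷ u) = trans (+-suc _ _) (cong suc (ham-complement x u))

ham-self-complement : (u : Vec Bool ℓ) → Ham u (complement u) ≡ ℓ
ham-self-complement [] = refl
ham-self-complement (true ∷ u) = cong suc (ham-self-complement u)
ham-self-complement (false ∷ u) = cong suc (ham-self-complement u)

-- It thus differs
-- from ū exactly on k positions, all of them agreements of x and u.
partialComplement : ℕ → Vec Bool ℓ → Vec Bool ℓ → Vec Bool ℓ
partialComplement zero x u = complement u
partialComplement (suc k) [] [] = []
partialComplement (suc k) (true ∷ x) (true ∷ u) = true ∷ partialComplement k x u
partialComplement (suc k) (false ∷ x) (false ∷ u) = false ∷ partialComplement k x u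
partialComplement (suc k) (true ∷ x) (false ∷ u) = true ∷ partialComplement (suc k) x u
partialComplement (suc k) (false ∷ x) (true ∷ u) = false ∷ partialComplement (suc k) x u

-- A disagreement at the head uses up one position of the budget ℓ but no k.
budget-tail : ∀ {k d ℓ} → suc k + suc d ≤ suc ℓ → suc k + d ≤ ℓ
budget-tail {k} {d} p rewrite +-suc k d = ≤-pred p

partialComplement-from-u : ∀ k (x u : Vec Bool ℓ) → k + Ham x u ≤ ℓ →
                           Ham u (partialComplement k x u) + k ≡ ℓ
partialComplement-from-u zero x u _ = trans (+-identityʳ _) (ham-self-complement u)
partialComplement-from-u (suc k) [] [] ()
partialComplement-from-u (suc k) (true ∷ x) (true ∷ u) (s≤s p) =
  trans (+-suc _ _) (cong suc (partialComplement-from-u k x u p))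
partialComplement-from-u (suc k) (false ∷ x) (false ∷ u) (s≤s p) =
  trans (+-suc _ _) (cong suc (partialComplement-from-u k x u p))
partialComplement-from-u (suc k) (true ∷ x) (false ∷ u) p =
  cong suc (partialComplement-from-u (suc k) x u (budget-tail p))
partialComplement-from-u (suc k) (false ∷ x) (true ∷ u) p =
  cong suc (partialComplement-from-u (suc k) x u (budget-tail p))

partialComplement-from-x : ∀ k (x u : Vec Bool ℓ) → k + Ham x u ≤ ℓ →
                           Ham x (partialComplement k x u) + k + Ham x u ≡ ℓ
partialComplement-from-x zero x u _ =
  trans (cong (_+ Ham x u) (+-identityʳ _)) (ham-complement x u)
partialComplement-from-x (suc k) [] [] ()
partialComplement-from-x (suc k) (true ∷ x) (true ∷ u) (s≤s p) =
  trans (cong (_+ Ham x u) (+-suc _ _)) (cong suc (partialComplement-from-x k x u p))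
partialComplement-from-x (suc k) (false ∷ x) (false ∷ u) (s≤s p) =
  trans (cong (_+ Ham x u) (+-suc _ _)) (cong suc (partialComplement-from-x k x u p))
partialComplement-from-x (suc k) (true ∷ x) (false ∷ u) p =
  trans (+-suc _ _) (cong suc (partialComplement-from-x (suc k) x u (budget-tail p)))
partialComplement-from-x (suc k) (false ∷ x) (true ∷ u) p =
  trans (+-suc _ _) (cong suc (partialComplement-from-x (suc k) x u (budget-tail p)))

partialComplement-from-complement : ∀ k (x u : Vec Bool ℓ) → k + Ham x u ≤ ℓ →
                                    Ham (complement u) (partialComplement k x u) ≡ k
partialComplement-from-complement k x u p = +-cancelʳ-≡ (Ham y u) _ _ (begin
    Ham (complement u) y + Ham y u ≡⟨ cong (_+ Ham y u) (ham-sym (complement u) y) ⟩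
    Ham y (complement u) + Ham y u ≡⟨ ham-complement y u ⟩
    _                              ≡⟨ sym (partialComplement-from-u k x u p) ⟩
    Ham u y + k                    ≡⟨ +-comm (Ham u y) k ⟩
    k + Ham u y                    ≡⟨ cong (k +_) (ham-sym u y) ⟩
    k + Ham y u                    ∎)
  where
  open ≡-Reasoning
  y = partialComplement k x u

partialComplement-from-any : ∀ k (x u z : Vec Bool ℓ) → k + Ham x u ≤ ℓ →
                             Ham z (partialComplement k x u) ≤ k + Ham z (complement u)
partialComplement-from-any k x u z p = begin
    Ham z y                                        ≤⟨ ham-triangle z (complement u) y ⟩
    Ham z (complement u) + Ham (complement u) y    ≡⟨ cong (Ham z (complement u) +_)
                                                         (partialComplement-from-complement k x u p) ⟩
    Ham z (complement u) + k                       ≡⟨ +-comm _ k ⟩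
    k + Ham z (complement u)                       ∎
  where
  open ≤-Reasoning
  y = partialComplement k x u

complement-share : ∀ {a b ℓ} → a + b ≡ ℓ → ℓ ≤ 10 * b → 10 * a ≤ 9 * ℓ
complement-share {a} {b} {ℓ} a+b≡ℓ ℓ≤10b = +-cancelʳ-≤ ℓ _ _ (begin
    10 * a + ℓ      ≤⟨ +-monoʳ-≤ (10 * a) ℓ≤10b ⟩
    10 * a + 10 * b ≡⟨ sym (*-distribˡ-+ 10 a b) ⟩
    10 * (a + b)    ≡⟨ cong (10 *_) a+b≡ℓ ⟩
    10 * ℓ          ≡⟨ *-distribʳ-+ ℓ 9 1 ⟩
    9 * ℓ + 1 * ℓ   ≡⟨ cong (9 * ℓ +_) (*-identityˡ ℓ) ⟩
    9 * ℓ + ℓ       ∎)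
  where open ≤-Reasoning

-- A string closer than ℓ/10 to u agrees with it in at least k positions.
enough-agreements : ∀ q d → 10 * d < q * 100 → q * 5 + d ≤ q * 100
enough-agreements q d 10d<ℓ = begin
    q * 5 + d      ≤⟨ +-monoʳ-≤ (q * 5) d≤ℓ/10 ⟩
    q * 5 + q * 10 ≡⟨ sym (*-distribˡ-+ q 5 10) ⟩
    q * 15         ≤⟨ *-monoʳ-≤ q (m≤m+n 15 85) ⟩
    q * 100        ∎
  where
  open ≤-Reasoning
  scale : ∀ q → q * 100 ≡ 10 * (q * 10)
  scale = solve-∀
  d≤ℓ/10 : d ≤ q * 10
  d≤ℓ/10 = *-cancelˡ-≤ 10 (≤-trans (<⇒≤ 10d<ℓ) (≤-reflexive (scale q)))

far-from-u : ∀ q h → h + q * 5 ≡ q * 100 → 19 * (q * 100) ≤ 20 * h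
far-from-u q h h+k≡ℓ = ≤-reflexive (+-cancelʳ-≡ (20 * (q * 5)) _ _ (begin
    19 * (q * 100) + 20 * (q * 5) ≡⟨ scale q ⟩
    20 * (q * 100)                ≡⟨ cong (20 *_) (sym h+k≡ℓ) ⟩
    20 * (h + q * 5)              ≡⟨ *-distribˡ-+ 20 h (q * 5) ⟩
    20 * h + 20 * (q * 5)         ∎))
  where
  open ≡-Reasoning
  scale : ∀ q → 19 * (q * 100) + 20 * (q * 5) ≡ 20 * (q * 100)
  scale = solve-∀

-- The centre x₀ near u: h = ℓ - k - d with d ≥ ℓ/20 gives h ≤ 9ℓ/10.
near-centre-bound : ∀ q h d → h + q * 5 + d ≡ q * 100 → q * 100 ≤ 20 * d →
                    10 * h ≤ 9 * (q * 100)
near-centre-bound q h d sum≡ℓ ℓ≤20d = *-cancelˡ-≤ 2 (+-cancelʳ-≤ (2 * (q * 100)) _ _ (begin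
    2 * (10 * h) + 2 * (q * 100)    ≡⟨ expand h q ⟩
    20 * h + 20 * (q * 5) + q * 100 ≤⟨ +-monoʳ-≤ (20 * h + 20 * (q * 5)) ℓ≤20d ⟩
    20 * h + 20 * (q * 5) + 20 * d  ≡⟨ collect h q d ⟩
    20 * (h + q * 5 + d)            ≡⟨ cong (20 *_) sum≡ℓ ⟩
    20 * (q * 100)                  ≡⟨ split q ⟩
    2 * (9 * (q * 100)) + 2 * (q * 100) ∎))
  where
  open ≤-Reasoning
  expand : ∀ h q → 2 * (10 * h) + 2 * (q * 100) ≡ 20 * h + 20 * (q * 5) + q * 100
  expand = solve-∀
  collect : ∀ h q d → 20 * h + 20 * (q * 5) + 20 * d ≡ 20 * (h + q * 5 + d)
  collect = solve-∀
  split : ∀ q → 20 * (q * 100) ≡ 2 * (9 * (q * 100)) + 2 * (q * 100)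
  split = solve-∀

other-centre-far-from-u : ∀ {ℓ t d d₀} → 49 * ℓ < 100 * t → t ≤ d + d₀ → 10 * d₀ < ℓ →
                          39 * ℓ ≤ 100 * d
other-centre-far-from-u {ℓ} {t} {d} {d₀} 49ℓ<100t t≤ 10d₀<ℓ = +-cancelʳ-≤ (10 * ℓ) _ _ (begin
    39 * ℓ + 10 * ℓ    ≡⟨ sym (*-distribʳ-+ ℓ 39 10) ⟩
    49 * ℓ             ≤⟨ <⇒≤ 49ℓ<100t ⟩
    100 * t            ≤⟨ *-monoʳ-≤ 100 t≤ ⟩
    100 * (d + d₀)     ≡⟨ *-distribˡ-+ 100 d d₀ ⟩
    100 * d + 100 * d₀ ≤⟨ +-monoʳ-≤ (100 * d) 100d₀≤10ℓ ⟩
    100 * d + 10 * ℓ   ∎)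
  where
  open ≤-Reasoning
  100d₀≤10ℓ : 100 * d₀ ≤ 10 * ℓ
  100d₀≤10ℓ = begin
    100 * d₀      ≡⟨ *-assoc 10 10 d₀ ⟩
    10 * (10 * d₀) ≤⟨ *-monoʳ-≤ 10 (<⇒≤ 10d₀<ℓ) ⟩
    10 * ℓ        ∎

-- Such a centre is within k + (ℓ - d) < 66ℓ/100 of the partial complement.
other-centre-bound : ∀ q h a d → h ≤ q * 5 + a → a + d ≡ q * 100 →
                     39 * (q * 100) ≤ 100 * d → 10 * h ≤ 9 * (q * 100)
other-centre-bound q h a d h≤k+a a+d≡ℓ 39ℓ≤100d =
  *-cancelˡ-≤ 10 (begin
    10 * (10 * h)      ≤⟨ 100h≤66ℓ ⟩
    66 * (q * 100)     ≤⟨ *-monoˡ-≤ (q * 100) (m≤m+n 66 24) ⟩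
    90 * (q * 100)     ≡⟨ scale q ⟩
    10 * (9 * (q * 100)) ∎)
  where
  open ≤-Reasoning
  regroup : ∀ q a d → 100 * (q * 5 + a) + 100 * d ≡ 5 * (q * 100) + 100 * (a + d)
  regroup = solve-∀
  split : ∀ q → 5 * (q * 100) + 100 * (q * 100) ≡ 66 * (q * 100) + 39 * (q * 100)
  split = solve-∀
  scale : ∀ q → 90 * (q * 100) ≡ 10 * (9 * (q * 100))
  scale = solve-∀
  100h≤66ℓ : 10 * (10 * h) ≤ 66 * (q * 100)
  100h≤66ℓ = +-cancelʳ-≤ (39 * (q * 100)) _ _ (begin
    10 * (10 * h) + 39 * (q * 100)   ≡⟨ cong (_+ 39 * (q * 100)) (sym (*-assoc 10 10 h)) ⟩
    100 * h + 39 * (q * 100)         ≤⟨ +-mono-≤ (*-monoʳ-≤ 100 h≤k+a) 39ℓ≤100d ⟩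
    100 * (q * 5 + a) + 100 * d      ≡⟨ regroup q a d ⟩
    5 * (q * 100) + 100 * (a + d)    ≡⟨ cong (λ s → 5 * (q * 100) + 100 * s) a+d≡ℓ ⟩
    5 * (q * 100) + 100 * (q * 100)  ≡⟨ split q ⟩
    66 * (q * 100) + 39 * (q * 100)  ∎)

complement-witness : (S : List (Vec Bool ℓ)) (u : Vec Bool ℓ) →
                     (∀ x → x ∈ S → ℓ ≤ 10 * Ham x u) →
                     InF S (complement u) × (19 * ℓ ≤ 20 * Ham u (complement u))
complement-witness {ℓ} S u far =
  (λ x x∈S → complement-share {Ham x (complement u)} (ham-complement x u) (far x x∈S)) ,
  ≤-trans (*-monoˡ-≤ ℓ (m≤m+n 19 1)) (≤-reflexive (cong (20 *_) (sym (ham-self-complement u))))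

partialComplement-witness :
  ∀ q (S : List (Vec Bool (q * 100))) →
  (∀ x y → x ∈ S → y ∈ S → x ≢ y → 49 * (q * 100) < 100 * Ham x y) →
  (u : Vec Bool (q * 100)) → (∀ x → x ∈ S → q * 100 ≤ 20 * Ham x u) →
  ∀ {x₀} → x₀ ∈ S → 10 * Ham x₀ u < q * 100 →
  Σ (Vec Bool (q * 100)) (λ y → InF S y × (19 * (q * 100) ≤ 20 * Ham u y))
partialComplement-witness q S separated u far {x₀} x₀∈S x₀-close =
  y , y∈F , far-from-u q (Ham u y) (partialComplement-from-u (q * 5) x₀ u k-fits)
  where
  k-fits : q * 5 + Ham x₀ u ≤ q * 100
  k-fits = enough-agreements q (Ham x₀ u) x₀-close
  y : Vec Bool (q * 100)
  y = partialComplement (q * 5) x₀ u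
  y∈F : InF S y
  y∈F x x∈S with ≡-dec Bool._≟_ x x₀
  ... | yes refl =
    near-centre-bound q (Ham x y) (Ham x u) (partialComplement-from-x (q * 5) x u k-fits) (far x x∈S)
  ... | no x≢x₀ =
    other-centre-bound q (Ham x y) (Ham x (complement u)) (Ham x u)
      (partialComplement-from-any (q * 5) x₀ u x k-fits) (ham-complement x u)
      (other-centre-far-from-u {d = Ham x u} (separated x x₀ x∈S x₀∈S x≢x₀) via-u x₀-close)
    where
    via-u : Ham x x₀ ≤ Ham x u + Ham x₀ u
    via-u = ≤-trans (ham-triangle x u x₀) (≤-reflexive (cong (Ham x u +_) (ham-sym u x₀)))

lemma2 : (n ℓ : ℕ) → 0 < n → 0 < ℓ → 100 ∣ ℓ →
         (S : List (Vec Bool ℓ)) → Unique S → length S ≡ n →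
         (∀ x → x ∈ S → 2 * Hw x ≡ ℓ) →
         (∀ x y → x ∈ S → y ∈ S → x ≢ y →
            (49 * ℓ < 100 * Ham x y) × (100 * Ham x y < 51 * ℓ)) →
         (u : Vec Bool ℓ) →
         ((u ∈ S → ∀ y → InF S y → 10 * Ham u y ≤ 9 * ℓ) ×
          ((∀ x → x ∈ S → ℓ ≤ 20 * Ham x u) →
             Σ (Vec Bool ℓ) (λ y → InF S y × (19 * ℓ ≤ 20 * Ham u y))))
lemma2 _ _ _ _ (divides q refl) S _ _ _ separated u = part1 , part2
  where
  part1 : u ∈ S → ∀ y → InF S y → 10 * Ham u y ≤ 9 * (q * 100)
  part1 u∈S y y∈F = y∈F u u∈S

  part2 : (∀ x → x ∈ S → q * 100 ≤ 20 * Ham x u) →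
          Σ (Vec Bool (q * 100)) (λ y → InF S y × (19 * (q * 100) ≤ 20 * Ham u y))
  part2 far with any? (λ x → 10 * Ham x u <? q * 100) S
  ... | yes some-close =
    let x₀ , x₀∈S , x₀-close = find some-close
    in partialComplement-witness q S
         (λ x y x∈S y∈S x≢y → proj₁ (separated x y x∈S y∈S x≢y))
         u far x₀∈S x₀-close
  ... | no none-close =
    complement u , complement-witness S u (λ x x∈S → ≮⇒≥ (λ close → none-close (lose x∈S close)))
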